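{- For all positive integers $n$, there are homomorphisms $\mathbf K_{b(n)}\to\delta_R\mathbf K_n\to\mathbf K_{2^n}$, where $b(n)=\binom{n}{\lfloor n/2\rfloor}$.
   Context: $\mathbf K_m$ is the complete loopless graph on $m$ vertices, viewed as a digraph with all arcs between distinct vertices. A homomorphism is an arc-preserving vertex map. For a digraph $\mathbf D$, $\delta_R\mathbf D$ is the digraph whose vertices are the pairs $(S,T)$ of (possibly empty) subsets $S,T\subseteq V(D)$ with $S\times T\subseteq E(D)$, with an arc from $(S,T)$ to $(S',T')$ iff $T\cap S'\neq\emptyset$. -}

module Defs where

open import Level using (0ℓ; suc)
open import Data.Nat using (ℕ; _/_)
open import Data.Nat.Combinatorics using (_C_)
open import Data.Fin using (Fin)
open import Data.Fin.Subset using (Subset; _∈_)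
open import Data.Product using (Σ; ∃; _×_; _,_; proj₁; proj₂)
open import Relation.Binary.PropositionalEquality using (_≢_)

record Digraph : Set₁ where
  field
    V : Set
    E : V → V → Set
open Digraph public

Hom : Digraph → Digraph → Set
Hom G H = Σ (V G → V H) λ f → ∀ {x y} → E G x y → E H (f x) (f y)

K : ℕ → Digraph
K m = record { V = Fin m ; E = λ i j → i ≢ j }

-- δ_R for a digraph on a finite vertex set Fin n with arc relation e.
-- Vertices: pairs (S , T) of subsets with S × T ⊆ E.
-- Arc (S,T) → (S',T') iff T ∩ S' ≠ ∅, i.e. some vertex lies in both.
δR : (n : ℕ) → (Fin n → Fin n → Set) → Digraph
δR n e = record
  { V = Σ (Subset n × Subset n) λ ST →
          ∀ s t → s ∈ proj₁ ST → t ∈ proj₂ ST → e s t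
  ; E = λ x y → ∃ λ v → v ∈ proj₂ (proj₁ x) × v ∈ proj₁ (proj₁ y)
  }

δRK : ℕ → Digraph
δRK n = δR n (E (K n))

b : ℕ → ℕ
b n = n C (n / 2)

-- Left map: send the i-th ⌊n/2⌋-subset S to (S , ∁ S).  Distinct sets of equal size are
-- incomparable, so for i ≢ j some element of S_j lies outside S_i, i.e. in ∁ S_i.
-- Right map: along an arc (S , T) → (S' , T') the sets S and S' differ, since a common
-- element of T and S' = S would be a loop of K n; so any injection of Subset n into
-- Fin (2 ^ n) is a homomorphism.
module Submission where

open import Defs
open import Data.Nat using (ℕ; zero; suc; _+_; _≤_; _^_; _/_; s≤s)
open import Data.Nat.Properties using (<⇒≤; <-irrefl; ≤-reflexive)
open import Data.Nat.Combinatorics using (_C_; nCk+nC[k+1]≡[n+1]C[k+1])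
open import Data.Product using (_×_; _,_; proj₁; ∃)
open import Data.Sum using (inj₁; inj₂; [_,_]′)
open import Data.Fin using (Fin; splitAt; join; funToFin; finToFun) renaming (zero to fzero; suc to fsuc)
open import Data.Fin.Properties using (join-splitAt; finToFun-funToFin; 2↔Bool)
open import Data.Fin.Subset using (Subset; _∈_; _∉_; ∁; ⊥; ∣_∣; inside; outside)
open import Data.Fin.Subset.Properties using (x∈∁p⇒x∉p; x∉p⇒x∈∁p; ∣⊥∣≡0; drop-there)
open import Data.Vec using ([]; _∷_; lookup; tabulate)
open import Data.Vec.Base using (here; there)
open import Data.Vec.Properties using (∷-injectiveʳ; tabulate-cong; tabulate∘lookup)
open import Function using (_∘_)
open import Function.Bundles using (Inverse)
open import Function.Definitions using (Injective)
open import Relation.Nullary using (contradiction)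
open import Relation.Binary.PropositionalEquality
  using (_≡_; _≢_; refl; sym; trans; cong; subst; module ≡-Reasoning)

private
  variable
    m n : ℕ

∃[x∈q∖p]-∷ : ∀ {p q : Subset n} a b →
             (∃ λ x → x ∈ q × x ∉ p) → ∃ λ x → x ∈ b ∷ q × x ∉ a ∷ p
∃[x∈q∖p]-∷ _ _ (x , x∈q , x∉p) = fsuc x , there x∈q , x∉p ∘ drop-there

∣p∣≤∣q∣⇒p≢q⇒∃[x∈q∖p] : {p q : Subset n} → ∣ p ∣ ≤ ∣ q ∣ → p ≢ q → ∃ λ x → x ∈ q × x ∉ p
∣p∣≤∣q∣⇒p≢q⇒∃[x∈q∖p] {p = []}          {[]}          _ p≢q = contradiction refl p≢q
∣p∣≤∣q∣⇒p≢q⇒∃[x∈q∖p] {p = outside ∷ p} {inside  ∷ q} _ _   = fzero , here , λ ()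
∣p∣≤∣q∣⇒p≢q⇒∃[x∈q∖p] {p = outside ∷ p} {outside ∷ q} ∣p∣≤∣q∣ p≢q =
  ∃[x∈q∖p]-∷ outside outside (∣p∣≤∣q∣⇒p≢q⇒∃[x∈q∖p] ∣p∣≤∣q∣ (p≢q ∘ cong (outside ∷_)))
∣p∣≤∣q∣⇒p≢q⇒∃[x∈q∖p] {p = inside  ∷ p} {inside  ∷ q} (s≤s ∣p∣≤∣q∣) p≢q =
  ∃[x∈q∖p]-∷ inside inside (∣p∣≤∣q∣⇒p≢q⇒∃[x∈q∖p] ∣p∣≤∣q∣ (p≢q ∘ cong (inside ∷_)))
∣p∣≤∣q∣⇒p≢q⇒∃[x∈q∖p] {p = inside  ∷ p} {outside ∷ q} ∣p∣<∣q∣ _ =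
  ∃[x∈q∖p]-∷ inside outside
    (∣p∣≤∣q∣⇒p≢q⇒∃[x∈q∖p] (<⇒≤ ∣p∣<∣q∣) λ { refl → <-irrefl refl ∣p∣<∣q∣ })

binom : ℕ → ℕ → ℕ
binom zero    zero    = 1
binom zero    (suc k) = 0
binom (suc n) zero    = 1
binom (suc n) (suc k) = binom n k + binom n (suc k)

binom≡C : ∀ n k → binom n k ≡ n C k
binom≡C zero    zero    = refl
binom≡C zero    (suc k) = refl
binom≡C (suc n) zero    = refl
binom≡C (suc n) (suc k) = begin
  binom n k + binom n (suc k) ≡⟨ cong (_+ binom n (suc k)) (binom≡C n k) ⟩
  n C k + binom n (suc k)     ≡⟨ cong (n C k +_) (binom≡C n (suc k)) ⟩
  n C k + n C suc k           ≡⟨ nCk+nC[k+1]≡[n+1]C[k+1] n k ⟩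
  suc n C suc k               ∎
  where open ≡-Reasoning

layer : ∀ n k → Fin (binom n k) → Subset n
layer zero    zero    _ = []
layer (suc n) zero    _ = ⊥
layer (suc n) (suc k) i =
  [ (inside ∷_) ∘ layer n k , (outside ∷_) ∘ layer n (suc k) ]′ (splitAt (binom n k) i)

∣layer∣≡k : ∀ n k i → ∣ layer n k i ∣ ≡ k
∣layer∣≡k zero    zero    _ = refl
∣layer∣≡k (suc n) zero    _ = ∣⊥∣≡0 n
∣layer∣≡k (suc n) (suc k) i with splitAt (binom n k) i
... | inj₁ a = cong suc (∣layer∣≡k n k a)
... | inj₂ c = ∣layer∣≡k n (suc k) c

splitAt-injective : ∀ m {n} → Injective _≡_ _≡_ (splitAt m {n})
splitAt-injective m {n} {i} {j} eq = begin
  i                       ≡⟨ join-splitAt m n i ⟨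
  join m n (splitAt m i)  ≡⟨ cong (join m n) eq ⟩
  join m n (splitAt m j)  ≡⟨ join-splitAt m n j ⟩
  j                       ∎
  where open ≡-Reasoning

layer-injective : ∀ n k → Injective _≡_ _≡_ (layer n k)
layer-injective zero    zero    {fzero} {fzero} _ = refl
layer-injective (suc n) zero    {fzero} {fzero} _ = refl
layer-injective (suc n) (suc k) {i} {j} eq =
  splitAt-injective (binom n k) (split-injective (splitAt _ i) (splitAt _ j) eq)
  where
  split-injective : ∀ a b →
    [ (inside ∷_) ∘ layer n k , (outside ∷_) ∘ layer n (suc k) ]′ a ≡
    [ (inside ∷_) ∘ layer n k , (outside ∷_) ∘ layer n (suc k) ]′ b → a ≡ b
  split-injective (inj₁ a) (inj₁ b) eq = cong inj₁ (layer-injective n k (∷-injectiveʳ eq))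
  split-injective (inj₂ a) (inj₂ b) eq = cong inj₂ (layer-injective n (suc k) (∷-injectiveʳ eq))
  split-injective (inj₁ _) (inj₂ _) ()
  split-injective (inj₂ _) (inj₁ _) ()

layer-∃[x∈q∖p] : ∀ n k {i j} → i ≢ j → ∃ λ x → x ∈ layer n k j × x ∉ layer n k i
layer-∃[x∈q∖p] n k {i} {j} i≢j = ∣p∣≤∣q∣⇒p≢q⇒∃[x∈q∖p]
  (≤-reflexive (trans (∣layer∣≡k n k i) (sym (∣layer∣≡k n k j))))
  (i≢j ∘ layer-injective n k)

antichain⇒Hom[K,δRK] : ∀ {m n} (f : Fin m → Subset n) →
                       (∀ {i j} → i ≢ j → ∃ λ x → x ∈ f j × x ∉ f i) → Hom (K m) (δRK n)
antichain⇒Hom[K,δRK] {m} {n} f incomparable = vertex , arc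
  where
  vertex : Fin m → V (δRK n)
  vertex i = (f i , ∁ (f i)) , λ s t s∈ t∈∁ s≡t → x∈∁p⇒x∉p t∈∁ (subst (_∈ f i) s≡t s∈)
  arc : ∀ {i j} → i ≢ j → E (δRK n) (vertex i) (vertex j)
  arc i≢j with x , x∈fj , x∉fi ← incomparable i≢j = x , x∉p⇒x∈∁p x∉fi , x∈fj

δRK-arc⇒≢ : {x y : V (δRK n)} → E (δRK n) x y → proj₁ (proj₁ x) ≢ proj₁ (proj₁ y)
δRK-arc⇒≢ {x = _ , S×T⊆E} (v , v∈T , v∈S′) S≡S′ = S×T⊆E v v (subst (v ∈_) (sym S≡S′) v∈S′) v∈T refl

Injective⇒Hom[δRK,K] : (code : Subset n → Fin m) → Injective _≡_ _≡_ code → Hom (δRK n) (K m)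
Injective⇒Hom[δRK,K] code code-injective =
  (λ x → code (proj₁ (proj₁ x))) , λ {x} {y} arc → δRK-arc⇒≢ {x = x} {y} arc ∘ code-injective

open Inverse 2↔Bool using (to; from; strictlyInverseˡ)

encode : Subset n → Fin (2 ^ n)
encode p = funToFin (from ∘ lookup p)

decode : Fin (2 ^ n) → Subset n
decode c = tabulate (to ∘ finToFun c)

decode∘encode : (p : Subset n) → decode (encode p) ≡ p
decode∘encode p = begin
  tabulate (to ∘ finToFun (encode p)) ≡⟨ tabulate-cong (cong to ∘ finToFun-funToFin (from ∘ lookup p)) ⟩
  tabulate (to ∘ from ∘ lookup p)     ≡⟨ tabulate-cong (strictlyInverseˡ ∘ lookup p) ⟩
  tabulate (lookup p)                 ≡⟨ tabulate∘lookup p ⟩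
  p                                   ∎
  where open ≡-Reasoning

encode-injective : Injective _≡_ _≡_ (encode {n})
encode-injective {x = p} {q} eq = begin
  p                   ≡⟨ decode∘encode p ⟨
  decode (encode p)   ≡⟨ cong decode eq ⟩
  decode (encode q)   ≡⟨ decode∘encode q ⟩
  q                   ∎
  where open ≡-Reasoning

mainTheorem16 : (n : ℕ) → 1 ≤ n →
    Hom (K (b n)) (δRK n) × Hom (δRK n) (K (2 ^ n))
mainTheorem16 n _ =
  subst (λ m → Hom (K m) (δRK n)) (binom≡C n (n / 2))
        (antichain⇒Hom[K,δRK] (layer n (n / 2)) (layer-∃[x∈q∖p] n (n / 2))) ,
  Injective⇒Hom[δRK,K] encode encode-injective
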